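{- Let $I=(V,\mathcal{C},k)$ be an irreducible instance of 3-Linear Ordering. Then for every triple of distinct variables $v_1,v_2,v_3$ with $\mathcal{C}\cap\Delta(v_1,v_2,v_3)\neq\emptyset$, there is a reverse pair $e,e'\in\Delta(v_1,v_2,v_3)$ that is absent in $I$.
   Context: 3-Linear Ordering: an instance $(V,\mathcal{C},k)$ consists of a finite variable set $V$, a multiset $\mathcal{C}$ of constraints, each an ordered tuple $e=(e(1),e(2),e(3))$ of three distinct variables or $e=(e(1),e(2))$ of two distinct variables, with integer weight $w(e)\ge0$, and an integer $k\ge0$. $\Delta(v_1,v_2,v_3)$ denotes the set of all six ordered triples of the distinct variables $v_1,v_2,v_3$. Two distinct $e,e'\in\Delta(v_1,v_2,v_3)$ form a reverse pair if $e'=(e(3),e(2),e(1))$; the pair is absent in $I$ if neither $e$ nor $e'$ belongs to $\mathcal{C}$. The instance is irreducible if none of the following five rules applies: (Redundancy) some variable of $V$ appears in no constraint, or some constraint has weight $0$; (Merging) two identical constraints occur in $\mathcal{C}$; (Cancellation) there are binary constraints $e_1,e_2$ with $e_2=(e_1(2),e_1(1))$; (Edge Replacement) there are ternary $e_1,e_2,e_3\in\mathcal{C}$ with $e_2=(e_1(2),e_1(1),e_1(3))$ and $e_3=(e_1(1),e_1(3),e_1(2))$; (Cycle Replacement) there are ternary $e_1,e_2,e_3\in\mathcal{C}$ with $e_2=(e_1(2),e_1(3),e_1(1))$ and $e_3=(e_1(3),e_1(1),e_1(2))$. -}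

module Defs where

open import Data.Nat using (ℕ)
open import Data.Fin using (Fin)
open import Data.List using (List; length; lookup; _∷_; [])
open import Data.List.Relation.Unary.All using (All)
open import Data.List.Relation.Unary.Any using (Any)
open import Data.List.Membership.Propositional using (_∈_)
open import Data.Product using (_×_; _,_; ∃-syntax)
open import Data.Sum using (_⊎_)
open import Relation.Binary.PropositionalEquality using (_≡_; _≢_)
open import Relation.Nullary using (¬_)

data Con (n : ℕ) : Set where
  tri : Fin n → Fin n → Fin n → Con n
  bin : Fin n → Fin n → Con n

Distinct : {n : ℕ} → Con n → Set
Distinct (tri a b c) = (a ≢ b) × (a ≢ c) × (b ≢ c)
Distinct (bin a b) = a ≢ b

Occurs : {n : ℕ} → Fin n → Con n → Set
Occurs v (tri a b c) = (v ≡ a) ⊎ (v ≡ b) ⊎ (v ≡ c)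
Occurs v (bin a b) = (v ≡ a) ⊎ (v ≡ b)

record WCon (n : ℕ) : Set where
  constructor _w:_
  field
    con : Con n
    weight : ℕ
open WCon public

-- An instance (V, C, k): V = Fin nvars, C a multiset (list) of weighted
-- constraints with pairwise distinct variables, k a natural number.
record Instance : Set where
  field
    nvars : ℕ
    cs : List (WCon nvars)
    wf : All (λ w → Distinct (con w)) cs
    k : ℕ
open Instance public

_∈C_ : {I : Instance} → Con (nvars I) → Set
_∈C_ {I} e = Any (λ w → con w ≡ e) (cs I)

Triple : ℕ → Set
Triple n = Fin n × Fin n × Fin n

TriIn : (I : Instance) → Triple (nvars I) → Set
TriIn I (a , b , c) = _∈C_ {I} (tri a b c)

Δ : {n : ℕ} → Fin n → Fin n → Fin n → List (Triple n)
Δ a b c = (a , b , c) ∷ (a , c , b) ∷ (b , a , c) ∷ (b , c , a) ∷ (c , a , b) ∷ (c , b , a) ∷ []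

rev : {n : ℕ} → Triple n → Triple n
rev (a , b , c) = (c , b , a)

AbsentReversePair : (I : Instance) → (v₁ v₂ v₃ : Fin (nvars I)) → Set
AbsentReversePair I v₁ v₂ v₃ =
  ∃[ e ] ∃[ e' ] (e ∈ Δ v₁ v₂ v₃ × e' ∈ Δ v₁ v₂ v₃ × e ≢ e' × e' ≡ rev e
                 × ¬ TriIn I e × ¬ TriIn I e')

RedundancyApplies : Instance → Set
RedundancyApplies I =
  (∃[ v ] ¬ Any (λ w → Occurs v (con w)) (cs I))
  ⊎ Any (λ w → weight w ≡ 0) (cs I)
  where open import Data.Nat using (zero)

MergingApplies : Instance → Set
MergingApplies I =
  ∃[ i ] ∃[ j ] (i ≢ j × con (lookup (cs I) i) ≡ con (lookup (cs I) j))

CancellationApplies : Instance → Set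
CancellationApplies I =
  ∃[ a ] ∃[ b ] (_∈C_ {I} (bin a b) × _∈C_ {I} (bin b a))

EdgeReplacementApplies : Instance → Set
EdgeReplacementApplies I =
  ∃[ a ] ∃[ b ] ∃[ c ] (_∈C_ {I} (tri a b c) × _∈C_ {I} (tri b a c) × _∈C_ {I} (tri a c b))

CycleReplacementApplies : Instance → Set
CycleReplacementApplies I =
  ∃[ a ] ∃[ b ] ∃[ c ] (_∈C_ {I} (tri a b c) × _∈C_ {I} (tri b c a) × _∈C_ {I} (tri c a b))

Irreducible : Instance → Set
Irreducible I =
  ¬ RedundancyApplies I × ¬ MergingApplies I × ¬ CancellationApplies I
  × ¬ EdgeReplacementApplies I × ¬ CycleReplacementApplies I

module Submission where

-- The six triples of Δ(a,b,c) fall into three reverse pairs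
--   {(a,b,c),(c,b,a)},  {(a,c,b),(b,c,a)},  {(b,a,c),(c,a,b)}.
-- Membership of a triple in C is decidable, so each pair is either absent
-- or has a present member.  If some pair is absent we are done (its two
-- triples differ because their outer variables are distinct).  Otherwise
-- we may pick one present triple from each pair; a check of the 2³ possible
-- choices shows that every such selection contains the three triples of an
-- Edge Replacement or of a Cycle Replacement, contradicting irreducibility.

open import Defs
open import Data.Fin using (Fin)
open import Data.Fin.Properties using () renaming (_≟_ to _≟-Fin_)
open import Data.List.Relation.Unary.Any using (Any; here; there; any?)
open import Data.List.Membership.Propositional using (_∈_)
open import Data.Product using (_×_; _,_; proj₁)
open import Data.Product.Properties using (≡-dec)
open import Data.Sum using (_⊎_; inj₁; inj₂; [_,_])
open import Data.Empty using (⊥-elim)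
open import Relation.Binary.Definitions using (DecidableEquality)
open import Relation.Binary.PropositionalEquality using (_≡_; _≢_; refl; cong)
open import Relation.Nullary using (Dec; yes; no; ¬_)
open import Relation.Nullary.Decidable using (map′)

_≟-Triple_ : ∀ {n} → DecidableEquality (Triple n)
_≟-Triple_ = ≡-dec _≟-Fin_ (≡-dec _≟-Fin_ _≟-Fin_)

triple : ∀ {n} → Triple n → Con n
triple (a , b , c) = tri a b c

tri-injective : ∀ {n} {a b c x y z : Fin n} →
  tri a b c ≡ tri x y z → (a , b , c) ≡ (x , y , z)
tri-injective refl = refl

_≟-Con_ : ∀ {n} → DecidableEquality (Con n)
tri a b c ≟-Con tri x y z =
  map′ (cong triple) tri-injective ((a , b , c) ≟-Triple (x , y , z))
tri _ _ _ ≟-Con bin _ _ = no λ ()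
bin _ _ ≟-Con tri _ _ _ = no λ ()
bin a b ≟-Con bin x y with a ≟-Fin x | b ≟-Fin y
... | yes refl | yes refl = yes refl
... | no a≢x   | _        = no λ { refl → a≢x refl }
... | yes _    | no b≢y   = no λ { refl → b≢y refl }

triIn? : (I : Instance) (t : Triple (nvars I)) → Dec (TriIn I t)
triIn? I (a , b , c) = any? (λ w → con w ≟-Con tri a b c) (cs I)

Absent : (I : Instance) → Triple (nvars I) → Set
Absent I t = ¬ TriIn I t × ¬ TriIn I (rev t)

Present : (I : Instance) → Triple (nvars I) → Set
Present I t = TriIn I t ⊎ TriIn I (rev t)

neitherOrEither : {P Q : Set} → Dec P → Dec Q → (¬ P × ¬ Q) ⊎ (P ⊎ Q)
neitherOrEither (yes p) _       = inj₂ (inj₁ p)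
neitherOrEither (no ¬p) (yes q) = inj₂ (inj₂ q)
neitherOrEither (no ¬p) (no ¬q) = inj₁ (¬p , ¬q)

absentOrPresent : (I : Instance) (t : Triple (nvars I)) → Absent I t ⊎ Present I t
absentOrPresent I t = neitherOrEither (triIn? I t) (triIn? I (rev t))

replacementApplies : (I : Instance) (a b c : Fin (nvars I)) →
  Present I (a , b , c) → Present I (a , c , b) → Present I (b , a , c) →
  EdgeReplacementApplies I ⊎ CycleReplacementApplies I
replacementApplies I a b c (inj₁ abc) (inj₁ acb) (inj₁ bac) = inj₁ (a , b , c , abc , bac , acb)
replacementApplies I a b c (inj₁ abc) (inj₁ acb) (inj₂ cab) = inj₁ (a , c , b , acb , cab , abc)
replacementApplies I a b c (inj₁ abc) (inj₂ bca) (inj₁ bac) = inj₁ (b , a , c , bac , abc , bca)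
replacementApplies I a b c (inj₁ abc) (inj₂ bca) (inj₂ cab) = inj₂ (a , b , c , abc , bca , cab)
replacementApplies I a b c (inj₂ cba) (inj₁ acb) (inj₁ bac) = inj₂ (c , b , a , cba , bac , acb)
replacementApplies I a b c (inj₂ cba) (inj₁ acb) (inj₂ cab) = inj₁ (c , a , b , cab , acb , cba)
replacementApplies I a b c (inj₂ cba) (inj₂ bca) (inj₁ bac) = inj₁ (b , c , a , bca , cba , bac)
replacementApplies I a b c (inj₂ cba) (inj₂ bca) (inj₂ cab) = inj₁ (c , b , a , cba , bca , cab)

absentReversePair : (I : Instance) (a b c x y z : Fin (nvars I)) →
  (x , y , z) ∈ Δ a b c → (z , y , x) ∈ Δ a b c → x ≢ z →
  Absent I (x , y , z) → AbsentReversePair I a b c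
absentReversePair I a b c x y z t∈Δ rev∈Δ x≢z (¬t , ¬rev) =
  (x , y , z) , (z , y , x) , t∈Δ , rev∈Δ , (λ t≡rev → x≢z (cong proj₁ t≡rev)) , refl , ¬t , ¬rev

lemma3 : (I : Instance) → Irreducible I →
    (v₁ v₂ v₃ : Fin (nvars I)) → v₁ ≢ v₂ → v₁ ≢ v₃ → v₂ ≢ v₃ →
    Any (TriIn I) (Δ v₁ v₂ v₃) →
    AbsentReversePair I v₁ v₂ v₃
lemma3 I (_ , _ , _ , noEdge , noCycle) a b c a≢b a≢c b≢c _
  with absentOrPresent I (a , b , c) | absentOrPresent I (a , c , b)
     | absentOrPresent I (b , a , c)
... | inj₁ absent | _ | _ =
  absentReversePair I a b c a b c (here refl) (there (there (there (there (there (here refl))))))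
    a≢c absent
... | inj₂ _ | inj₁ absent | _ =
  absentReversePair I a b c a c b (there (here refl)) (there (there (there (here refl))))
    a≢b absent
... | inj₂ _ | inj₂ _ | inj₁ absent =
  absentReversePair I a b c b a c (there (there (here refl))) (there (there (there (there (here refl)))))
    b≢c absent
... | inj₂ abc | inj₂ acb | inj₂ bac =
  ⊥-elim ([ noEdge , noCycle ] (replacementApplies I a b c abc acb bac))
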